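{- For every integer $n\ge 0$, \[ x\,\mathrm{Bel}_{n,\lambda}^{(1)}(x)=\sum_{m=0}^{n}\frac{1}{m+1}\binom{n}{m}\beta_{n-m,\lambda}\,\mathrm{Bel}_{m+1,\lambda}(x), \] and in particular (taking $x=1$) \[ \mathrm{Bel}_{n,\lambda}^{(1)}=\sum_{m=0}^{n}\frac{1}{m+1}\binom{n}{m}\beta_{n-m,\lambda}\,\mathrm{Bel}_{m+1,\lambda}. \]
   Context: Let $\lambda\in\mathbb{R}$. Set $(x)_{0,\lambda}=1$, $(x)_{n,\lambda}=x(x-\lambda)\cdots(x-(n-1)\lambda)$ for $n\ge1$. The degenerate exponential is the formal power series $e_\lambda^x(t)=\sum_{n\ge0}(x)_{n,\lambda}\frac{t^n}{n!}$ ($=(1+\lambda t)^{x/\lambda}$, and $e^{xt}$ if $\lambda=0$), $e_\lambda(t)=e_\lambda^1(t)$. Degenerate Bell polynomials: $e^{x(e_\lambda(t)-1)}=\sum_{n\ge0}\mathrm{Bel}_{n,\lambda}(x)\frac{t^n}{n!}$, and $\mathrm{Bel}_{n,\lambda}=\mathrm{Bel}_{n,\lambda}(1)$. Carlitz's degenerate Bernoulli numbers $\beta_{n,\lambda}$: $\frac{t}{e_\lambda(t)-1}=\sum_{n\ge0}\beta_{n,\lambda}\frac{t^n}{n!}$. For an integer $p\ge0$, the truncated degenerate Bell polynomials are defined by $\sum_{n\ge0}\mathrm{Bel}^{(p)}_{n,\lambda}(x)\frac{t^n}{n!}=\frac{p!}{x^p(e_\lambda(t)-1)^p}\Big(e^{x(e_\lambda(t)-1)}-\sum_{k=0}^{p-1}\frac{x^k(e_\lambda(t)-1)^k}{k!}\Big)=p!\sum_{k\ge0}\frac{x^k(e_\lambda(t)-1)^k}{(k+p)!}$,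 and $\mathrm{Bel}^{(p)}_{n,\lambda}=\mathrm{Bel}^{(p)}_{n,\lambda}(1)$.
   Formalization: The parameter λ and the variable x are rational instead of real. -}

module Defs where

open import Data.Nat using (ℕ; zero; suc; _∸_)
open import Data.Nat.Combinatorics using (_C_)
open import Data.Integer using (+_)
open import Data.Rational using (ℚ; 0ℚ; 1ℚ; _+_; _*_; _-_; -_; _/_)

ℕ→ℚ : ℕ → ℚ
ℕ→ℚ n = + n / 1

Σ≤ : ℕ → (ℕ → ℚ) → ℚ
Σ≤ zero    f = f 0
Σ≤ (suc n) f = Σ≤ n f + f (suc n)

fact : ℕ → ℚ
fact zero    = 1ℚ
fact (suc n) = fact n * ℕ→ℚ (suc n)

invFact : ℕ → ℚ
invFact zero    = 1ℚ
invFact (suc n) = invFact n * (+ 1 / suc n)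

fall : ℚ → ℚ → ℕ → ℚ
fall x lam zero    = 1ℚ
fall x lam (suc n) = fall x lam n * (x - ℕ→ℚ n * lam)

-- formal power series in t, given by ordinary coefficients: F = Σ F n t^n
Series : Set
Series = ℕ → ℚ

oneS : Series
oneS zero    = 1ℚ
oneS (suc _) = 0ℚ

scaleS : ℚ → Series → Series
scaleS c F n = c * F n

mulS : Series → Series → Series
mulS F G n = Σ≤ n (λ i → F i * G (n ∸ i))

powS : Series → ℕ → Series
powS F zero    = oneS
powS F (suc k) = mulS F (powS F k)

-- e_λ(t) - 1 = Σ_{n≥1} (1)_{n,λ} t^n / n!
eλm1 : ℚ → Series
eλm1 lam zero    = 0ℚ
eλm1 lam (suc n) = fall 1ℚ lam (suc n) * invFact (suc n)

-- exp(G) for G with zero constant term: Σ_k G^k / k!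
-- (coefficient of t^n only receives contributions from k ≤ n)
expS : Series → Series
expS G n = Σ≤ n (λ k → invFact k * powS G k n)

-- Degenerate Bell polynomials: e^{x(e_λ(t)-1)} = Σ Bel_{n,λ}(x) t^n/n!
Bel : ℕ → ℚ → ℚ → ℚ
Bel n lam x = fact n * expS (scaleS x (eλm1 lam)) n

-- Truncated degenerate Bell polynomials with p = 1:
-- Σ Bel^{(1)}_{n,λ}(x) t^n/n! = 1! Σ_{k≥0} x^k (e_λ(t)-1)^k / (k+1)!
Bel1 : ℕ → ℚ → ℚ → ℚ
Bel1 n lam x = fact n * Σ≤ n (λ k → invFact (suc k) * powS (scaleS x (eλm1 lam)) k n)

-- multiplicative inverse of a series D with D 0 = 1:
-- returns [b_n, b_{n-1}, ..., b_0]
open import Data.List using (List; []; _∷_)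

private
  lookupL : List ℚ → ℕ → ℚ
  lookupL []       _       = 0ℚ
  lookupL (b ∷ bs) zero    = b
  lookupL (b ∷ bs) (suc i) = lookupL bs i

  invList : Series → ℕ → List ℚ
  invList D zero    = 1ℚ ∷ []
  invList D (suc n) = let bs = invList D n in
    (- Σ≤ n (λ k → D (suc k) * lookupL bs k)) ∷ bs

  headL : List ℚ → ℚ
  headL []      = 0ℚ
  headL (b ∷ _) = b

invS : Series → Series
invS D n = headL (invList D n)

-- (e_λ(t) - 1)/t, which has constant term (1)_{1,λ} = 1
eλm1/t : ℚ → Series
eλm1/t lam n = eλm1 lam (suc n)

-- Carlitz degenerate Bernoulli numbers: t/(e_λ(t)-1) = Σ β_{n,λ} t^n/n!
β : ℕ → ℚ → ℚ
β n lam = fact n * invS (eλm1/t lam) n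

{-# OPTIONS --safe #-}

-- Write F = x(e_λ(t) - 1) = t·x·D with D = (e_λ(t) - 1)/t, and let E = (e^F - 1)/F, the generating
-- series of Bel^{(1)}_{n,λ}(x)/n!. Then (e^F - 1)/t = x·D·E, and dividing by D (whose inverse is the
-- generating series of β_{n,λ}/n!) gives ((e^F - 1)/t)·D⁻¹ = x·E. Comparing the coefficients of t^n
-- of both sides yields the identity; the binomial coefficients come from converting ordinary into
-- exponential coefficients.
module Submission where

open import Defs
open import Data.Nat using (ℕ; suc; _∸_)
open import Data.Nat.Combinatorics using (_C_)
open import Data.Integer using (+_)
open import Data.Rational using (ℚ; 1ℚ; _*_; _/_)
open import Data.Product using (_×_)
open import Relation.Binary.PropositionalEquality using (_≡_)

open import Data.Nat as ℕ using (zero; _≤_; _<_; _≤′_; ≤′-refl; ≤′-step; z≤n; s≤s; _!)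
import Data.Nat.Properties as ℕ
import Data.Nat.Combinatorics as ℕ
import Data.Nat.DivMod as ℕ
import Data.Nat.Coprimality as Coprimality
import Data.Integer as ℤ
import Data.Integer.Properties as ℤ
open import Data.Rational using (mkℚ; 0ℚ; _+_; -_)
import Data.Rational.Properties as ℚ
open import Data.Rational.Solver using (module +-*-Solver)
open import Data.Product using (Σ; _,_; proj₁; proj₂)
open import Function using (_∘_)
open import Relation.Binary.PropositionalEquality using (refl; sym; trans; cong; cong₂; module ≡-Reasoning)
open ≡-Reasoning
open +-*-Solver using (solve; _:=_; _:*_; _:+_)

private
  variable
    m n N : ℕ
    f g : ℕ → ℚ
    F F′ H H′ : Series

Σ≤-cong : ∀ n → (∀ i → f i ≡ g i) → Σ≤ n f ≡ Σ≤ n g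
Σ≤-cong zero    f≡g = f≡g 0
Σ≤-cong (suc n) f≡g = cong₂ _+_ (Σ≤-cong n f≡g) (f≡g (suc n))

Σ≤-cong-≤ : ∀ n → (∀ i → i ≤ n → f i ≡ g i) → Σ≤ n f ≡ Σ≤ n g
Σ≤-cong-≤ zero    f≡g = f≡g 0 z≤n
Σ≤-cong-≤ (suc n) f≡g =
  cong₂ _+_ (Σ≤-cong-≤ n (λ i i≤n → f≡g i (ℕ.m≤n⇒m≤1+n i≤n))) (f≡g (suc n) ℕ.≤-refl)

Σ≤-zero : ∀ n → (∀ i → i ≤ n → f i ≡ 0ℚ) → Σ≤ n f ≡ 0ℚ
Σ≤-zero zero    f≡0 = f≡0 0 z≤n
Σ≤-zero (suc n) f≡0 =
  cong₂ _+_ (Σ≤-zero n (λ i i≤n → f≡0 i (ℕ.m≤n⇒m≤1+n i≤n))) (f≡0 (suc n) ℕ.≤-refl)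

Σ≤-extend : (∀ i → m < i → f i ≡ 0ℚ) → m ≤ N → Σ≤ N f ≡ Σ≤ m f
Σ≤-extend {m} {f = f} f≡0 m≤N = go (ℕ.≤⇒≤′ m≤N)
  where
  go : ∀ {N} → m ≤′ N → Σ≤ N f ≡ Σ≤ m f
  go ≤′-refl            = refl
  go (≤′-step {N} m≤′N) = begin
    Σ≤ N f + f (suc N) ≡⟨ cong₂ _+_ (go m≤′N) (f≡0 (suc N) (s≤s (ℕ.≤′⇒≤ m≤′N))) ⟩
    Σ≤ m f + 0ℚ        ≡⟨ ℚ.+-identityʳ _ ⟩
    Σ≤ m f             ∎

Σ≤-distrib-+ : ∀ n (f g : ℕ → ℚ) → Σ≤ n (λ i → f i + g i) ≡ Σ≤ n f + Σ≤ n g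
Σ≤-distrib-+ zero    f g = refl
Σ≤-distrib-+ (suc n) f g = begin
  Σ≤ n (λ i → f i + g i) + (f (suc n) + g (suc n))
    ≡⟨ cong (_+ (f (suc n) + g (suc n))) (Σ≤-distrib-+ n f g) ⟩
  (Σ≤ n f + Σ≤ n g) + (f (suc n) + g (suc n))
    ≡⟨ solve 4 (λ a b c d → (a :+ b) :+ (c :+ d) := (a :+ c) :+ (b :+ d)) refl
         (Σ≤ n f) (Σ≤ n g) (f (suc n)) (g (suc n)) ⟩
  (Σ≤ n f + f (suc n)) + (Σ≤ n g + g (suc n)) ∎

*-distribˡ-Σ≤ : ∀ n c (f : ℕ → ℚ) → c * Σ≤ n f ≡ Σ≤ n (λ i → c * f i)
*-distribˡ-Σ≤ zero    c f = refl
*-distribˡ-Σ≤ (suc n) c f =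
  trans (ℚ.*-distribˡ-+ c (Σ≤ n f) (f (suc n))) (cong (_+ c * f (suc n)) (*-distribˡ-Σ≤ n c f))

*-distribʳ-Σ≤ : ∀ n c (f : ℕ → ℚ) → Σ≤ n f * c ≡ Σ≤ n (λ i → f i * c)
*-distribʳ-Σ≤ n c f = begin
  Σ≤ n f * c             ≡⟨ ℚ.*-comm (Σ≤ n f) c ⟩
  c * Σ≤ n f             ≡⟨ *-distribˡ-Σ≤ n c f ⟩
  Σ≤ n (λ i → c * f i)   ≡⟨ Σ≤-cong n (λ i → ℚ.*-comm c (f i)) ⟩
  Σ≤ n (λ i → f i * c)   ∎

Σ≤-suc : ∀ n (f : ℕ → ℚ) → Σ≤ (suc n) f ≡ f 0 + Σ≤ n (f ∘ suc)
Σ≤-suc zero    f = refl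
Σ≤-suc (suc n) f = begin
  Σ≤ (suc n) f + f (suc (suc n))                ≡⟨ cong (_+ f (suc (suc n))) (Σ≤-suc n f) ⟩
  (f 0 + Σ≤ n (f ∘ suc)) + f (suc (suc n))      ≡⟨ ℚ.+-assoc (f 0) _ _ ⟩
  f 0 + Σ≤ (suc n) (f ∘ suc)                    ∎

Σ≤-comm : ∀ n N (g : ℕ → ℕ → ℚ) → Σ≤ n (λ i → Σ≤ N (g i)) ≡ Σ≤ N (λ k → Σ≤ n (λ i → g i k))
Σ≤-comm zero    N g = refl
Σ≤-comm (suc n) N g = begin
  Σ≤ n (λ i → Σ≤ N (g i)) + Σ≤ N (g (suc n))
    ≡⟨ cong (_+ Σ≤ N (g (suc n))) (Σ≤-comm n N g) ⟩
  Σ≤ N (λ k → Σ≤ n (λ i → g i k)) + Σ≤ N (g (suc n))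
    ≡⟨ Σ≤-distrib-+ N _ _ ⟨
  Σ≤ N (λ k → Σ≤ (suc n) (λ i → g i k)) ∎

Σ≤-reverse : ∀ n (f : ℕ → ℚ) → Σ≤ n f ≡ Σ≤ n (λ i → f (n ∸ i))
Σ≤-reverse zero    f = refl
Σ≤-reverse (suc n) f = begin
  Σ≤ (suc n) f                              ≡⟨ Σ≤-suc n f ⟩
  f 0 + Σ≤ n (f ∘ suc)                      ≡⟨ cong (λ z → f 0 + z) (Σ≤-reverse n (f ∘ suc)) ⟩
  f 0 + Σ≤ n (λ i → f (suc (n ∸ i)))        ≡⟨ ℚ.+-comm (f 0) _ ⟩
  Σ≤ n (λ i → f (suc (n ∸ i))) + f 0
    ≡⟨ cong₂ _+_ (Σ≤-cong-≤ n (λ i i≤n → cong f (sym (ℕ.+-∸-assoc 1 i≤n)))) (cong f (sym (ℕ.n∸n≡0 n))) ⟩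
  Σ≤ (suc n) (λ i → f (suc n ∸ i))          ∎

Σ≤-triangle : ∀ n (g : ℕ → ℕ → ℚ) →
  Σ≤ n (λ i → Σ≤ (n ∸ i) (g i)) ≡ Σ≤ n (λ s → Σ≤ s (λ i → g i (s ∸ i)))
Σ≤-triangle zero    g = refl
Σ≤-triangle (suc n) g = begin
  Σ≤ n (λ i → Σ≤ (suc n ∸ i) (g i)) + Σ≤ (n ∸ n) (g (suc n))
    ≡⟨ cong₂ _+_ (Σ≤-cong-≤ n (λ i i≤n → cong (λ k → Σ≤ k (g i)) (ℕ.+-∸-assoc 1 i≤n)))
                 (cong (λ k → Σ≤ k (g (suc n))) (ℕ.n∸n≡0 n)) ⟩
  Σ≤ n (λ i → Σ≤ (n ∸ i) (g i) + g i (suc (n ∸ i))) + g (suc n) 0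
    ≡⟨ cong (_+ g (suc n) 0) (Σ≤-distrib-+ n _ _) ⟩
  (Σ≤ n (λ i → Σ≤ (n ∸ i) (g i)) + Σ≤ n (λ i → g i (suc (n ∸ i)))) + g (suc n) 0
    ≡⟨ ℚ.+-assoc (Σ≤ n (λ i → Σ≤ (n ∸ i) (g i))) _ _ ⟩
  Σ≤ n (λ i → Σ≤ (n ∸ i) (g i)) + (Σ≤ n (λ i → g i (suc (n ∸ i))) + g (suc n) 0)
    ≡⟨ cong₂ _+_ (Σ≤-triangle n g)
         (cong₂ _+_ (Σ≤-cong-≤ n (λ i i≤n → cong (g i) (sym (ℕ.+-∸-assoc 1 i≤n))))
                    (cong (g (suc n)) (sym (ℕ.n∸n≡0 n)))) ⟩
  Σ≤ n (λ s → Σ≤ s (λ i → g i (s ∸ i))) + Σ≤ (suc n) (λ i → g i (suc n ∸ i)) ∎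

infix 4 _≐_

_≐_ : Series → Series → Set
F ≐ G = ∀ n → F n ≡ G n

mulS-congˡ : ∀ H → F ≐ F′ → mulS F H ≐ mulS F′ H
mulS-congˡ H F≐F′ n = Σ≤-cong n (λ i → cong (_* H (n ∸ i)) (F≐F′ i))

mulS-congʳ : ∀ F → H ≐ H′ → mulS F H ≐ mulS F H′
mulS-congʳ F H≐H′ n = Σ≤-cong n (λ i → cong (F i *_) (H≐H′ (n ∸ i)))

mulS-comm : ∀ F H → mulS F H ≐ mulS H F
mulS-comm F H n = begin
  Σ≤ n (λ i → F i * H (n ∸ i))                  ≡⟨ Σ≤-reverse n _ ⟩
  Σ≤ n (λ i → F (n ∸ i) * H (n ∸ (n ∸ i)))
    ≡⟨ Σ≤-cong-≤ n (λ i i≤n → trans (cong (λ k → F (n ∸ i) * H k) (ℕ.m∸[m∸n]≡n i≤n))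
                                     (ℚ.*-comm (F (n ∸ i)) (H i))) ⟩
  Σ≤ n (λ i → H i * F (n ∸ i))                  ∎

mulS-assoc : ∀ F G H → mulS (mulS F G) H ≐ mulS F (mulS G H)
mulS-assoc F G H n = begin
  Σ≤ n (λ s → Σ≤ s (λ i → F i * G (s ∸ i)) * H (n ∸ s))
    ≡⟨ Σ≤-cong n (λ s → *-distribʳ-Σ≤ s (H (n ∸ s)) _) ⟩
  Σ≤ n (λ s → Σ≤ s (λ i → F i * G (s ∸ i) * H (n ∸ s)))
    ≡⟨ Σ≤-cong-≤ n (λ s s≤n → Σ≤-cong-≤ s (λ i i≤s →
         trans (ℚ.*-assoc (F i) (G (s ∸ i)) (H (n ∸ s)))
               (cong (λ k → F i * (G (s ∸ i) * H k)) (sym (∸-∸-∸ s≤n i≤s))))) ⟩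
  Σ≤ n (λ s → Σ≤ s (λ i → F i * (G (s ∸ i) * H (n ∸ i ∸ (s ∸ i)))))
    ≡⟨ Σ≤-triangle n (λ i j → F i * (G j * H (n ∸ i ∸ j))) ⟨
  Σ≤ n (λ i → Σ≤ (n ∸ i) (λ j → F i * (G j * H (n ∸ i ∸ j))))
    ≡⟨ Σ≤-cong n (λ i → *-distribˡ-Σ≤ (n ∸ i) (F i) _) ⟨
  Σ≤ n (λ i → F i * Σ≤ (n ∸ i) (λ j → G j * H (n ∸ i ∸ j))) ∎
  where
  ∸-∸-∸ : ∀ {n s i} → s ≤ n → i ≤ s → n ∸ i ∸ (s ∸ i) ≡ n ∸ s
  ∸-∸-∸ {n} {s} {i} s≤n i≤s = trans (ℕ.∸-+-assoc n i (s ∸ i)) (cong (n ∸_) (ℕ.m+[n∸m]≡n i≤s))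

mulS-identityʳ : ∀ F → mulS F oneS ≐ F
mulS-identityʳ F zero    = ℚ.*-identityʳ (F 0)
mulS-identityʳ F (suc n) = begin
  Σ≤ n (λ i → F i * oneS (suc n ∸ i)) + F (suc n) * oneS (n ∸ n)
    ≡⟨ cong₂ _+_ (Σ≤-zero n (λ i i≤n → trans (cong (λ k → F i * oneS k) (ℕ.+-∸-assoc 1 i≤n)) (ℚ.*-zeroʳ (F i))))
                 (cong (λ k → F (suc n) * oneS k) (ℕ.n∸n≡0 n)) ⟩
  0ℚ + F (suc n) * 1ℚ ≡⟨ ℚ.+-identityˡ _ ⟩
  F (suc n) * 1ℚ      ≡⟨ ℚ.*-identityʳ _ ⟩
  F (suc n)           ∎

mulS-scaleˡ : ∀ c F H → mulS (scaleS c F) H ≐ scaleS c (mulS F H)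
mulS-scaleˡ c F H n = begin
  Σ≤ n (λ i → c * F i * H (n ∸ i))    ≡⟨ Σ≤-cong n (λ i → ℚ.*-assoc c (F i) (H (n ∸ i))) ⟩
  Σ≤ n (λ i → c * (F i * H (n ∸ i)))  ≡⟨ *-distribˡ-Σ≤ n c _ ⟨
  c * mulS F H n                       ∎

mulS-scaleʳ : ∀ c F H → mulS F (scaleS c H) ≐ scaleS c (mulS F H)
mulS-scaleʳ c F H n = begin
  Σ≤ n (λ i → F i * (c * H (n ∸ i)))
    ≡⟨ Σ≤-cong n (λ i → solve 3 (λ a b d → a :* (b :* d) := b :* (a :* d)) refl (F i) c (H (n ∸ i))) ⟩
  Σ≤ n (λ i → c * (F i * H (n ∸ i)))  ≡⟨ *-distribˡ-Σ≤ n c _ ⟨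
  c * mulS F H n                       ∎

mulS-Σ≤ʳ : ∀ N F (H : ℕ → Series) n →
  mulS F (λ m → Σ≤ N (λ k → H k m)) n ≡ Σ≤ N (λ k → mulS F (H k) n)
mulS-Σ≤ʳ N F H n = begin
  Σ≤ n (λ i → F i * Σ≤ N (λ k → H k (n ∸ i)))   ≡⟨ Σ≤-cong n (λ i → *-distribˡ-Σ≤ N (F i) _) ⟩
  Σ≤ n (λ i → Σ≤ N (λ k → F i * H k (n ∸ i)))   ≡⟨ Σ≤-comm n N _ ⟩
  Σ≤ N (λ k → mulS F (H k) n)                   ∎

mulS-shiftˡ : ∀ F → F 0 ≡ 0ℚ → ∀ H n → mulS F H (suc n) ≡ mulS (F ∘ suc) H n
mulS-shiftˡ F F0≡0 H n = begin
  Σ≤ (suc n) (λ i → F i * H (suc n ∸ i))              ≡⟨ Σ≤-suc n _ ⟩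
  F 0 * H (suc n) + Σ≤ n (λ i → F (suc i) * H (n ∸ i))
    ≡⟨ cong (_+ mulS (F ∘ suc) H n) (trans (cong (_* H (suc n)) F0≡0) (ℚ.*-zeroˡ (H (suc n)))) ⟩
  0ℚ + mulS (F ∘ suc) H n                              ≡⟨ ℚ.+-identityˡ _ ⟩
  mulS (F ∘ suc) H n                                   ∎

powS-vanish : ∀ F → F 0 ≡ 0ℚ → ∀ k m → m < k → powS F k m ≡ 0ℚ
powS-vanish F F0≡0 (suc k) zero    _         = trans (cong (_* powS F k 0) F0≡0) (ℚ.*-zeroˡ (powS F k 0))
powS-vanish F F0≡0 (suc k) (suc m) (s≤s m<k) = begin
  mulS F (powS F k) (suc m)      ≡⟨ mulS-shiftˡ F F0≡0 (powS F k) m ⟩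
  mulS (F ∘ suc) (powS F k) m    ≡⟨ Σ≤-zero m (λ i _ → trans
                                      (cong (F (suc i) *_) (powS-vanish F F0≡0 k (m ∸ i) (ℕ.≤-<-trans (ℕ.m∸n≤m m i) m<k)))
                                      (ℚ.*-zeroʳ (F (suc i)))) ⟩
  0ℚ                             ∎

-- invS is computed by helpers that Defs keeps private. The type below mentions only the recurrence,
-- and Agda infers (and thereby names) the list lookup that invS D (suc n) unfolds to.
private
  invS-unfold : ∀ D n → Σ (ℕ → ℚ) λ b → invS D (suc n) ≡ - Σ≤ n (λ k → D (suc k) * b k)
  invS-unfold D n = _ , refl

  earlierCoeff : Series → ℕ → ℕ → ℚ
  earlierCoeff D n = proj₁ (invS-unfold D n)

  earlierCoeff≡invS : ∀ D {n k} → k ≤ n → earlierCoeff D n k ≡ invS D (n ∸ k)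
  earlierCoeff≡invS D {zero}  z≤n       = refl
  earlierCoeff≡invS D {suc n} z≤n       = refl
  earlierCoeff≡invS D {suc n} (s≤s k≤n) = earlierCoeff≡invS D k≤n

invS-suc : ∀ D n → invS D (suc n) ≡ - Σ≤ n (λ k → D (suc k) * invS D (n ∸ k))
invS-suc D n = trans (proj₂ (invS-unfold D n))
  (cong -_ (Σ≤-cong-≤ n (λ k k≤n → cong (D (suc k) *_) (earlierCoeff≡invS D k≤n))))

mulS-inverseʳ : ∀ D → D 0 ≡ 1ℚ → mulS D (invS D) ≐ oneS
mulS-inverseʳ D D0≡1 zero    = cong (_* 1ℚ) D0≡1
mulS-inverseʳ D D0≡1 (suc n) = begin
  Σ≤ (suc n) (λ i → D i * invS D (suc n ∸ i))                     ≡⟨ Σ≤-suc n _ ⟩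
  D 0 * invS D (suc n) + S
    ≡⟨ cong (_+ S) (trans (cong₂ _*_ D0≡1 (invS-suc D n)) (ℚ.*-identityˡ (- S))) ⟩
  - S + S                                                          ≡⟨ ℚ.+-inverseˡ S ⟩
  0ℚ                                                               ∎
  where S = Σ≤ n (λ k → D (suc k) * invS D (n ∸ k))

mulS-invS-cancel : ∀ D → D 0 ≡ 1ℚ → ∀ H → mulS (mulS D H) (invS D) ≐ H
mulS-invS-cancel D D0≡1 H n = begin
  mulS (mulS D H) (invS D) n  ≡⟨ mulS-congˡ (invS D) (mulS-comm D H) n ⟩
  mulS (mulS H D) (invS D) n  ≡⟨ mulS-assoc H D (invS D) n ⟩
  mulS H (mulS D (invS D)) n  ≡⟨ mulS-congʳ H (mulS-inverseʳ D D0≡1) n ⟩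
  mulS H oneS n               ≡⟨ mulS-identityʳ H n ⟩
  H n                         ∎

-- (e^F - 1)/F = Σ_k F^k/(k+1)!; when F 0 ≡ 0 only k ≤ m contributes to the coefficient of t^m.
-- Bel1 n lam x unfolds to fact n * expS₁ (scaleS x (eλm1 lam)) n.
expS₁ : Series → Series
expS₁ F m = Σ≤ m (λ k → invFact (suc k) * powS F k m)

expS₁-extend : ∀ F → F 0 ≡ 0ℚ → m ≤ N → Σ≤ N (λ k → invFact (suc k) * powS F k m) ≡ expS₁ F m
expS₁-extend F F0≡0 = Σ≤-extend λ k m<k →
  trans (cong (invFact (suc k) *_) (powS-vanish F F0≡0 k _ m<k)) (ℚ.*-zeroʳ (invFact (suc k)))

expS-suc : ∀ F → F 0 ≡ 0ℚ → ∀ n → expS F (suc n) ≡ mulS (F ∘ suc) (expS₁ F) n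
expS-suc F F0≡0 n = begin
  expS F (suc n)                                                    ≡⟨ Σ≤-suc n _ ⟩
  0ℚ + Σ≤ n (λ k → c k * powS F (suc k) (suc n))                    ≡⟨ ℚ.+-identityˡ _ ⟩
  Σ≤ n (λ k → c k * powS F (suc k) (suc n))
    ≡⟨ Σ≤-cong n (λ k → cong (c k *_) (mulS-shiftˡ F F0≡0 (powS F k) n)) ⟩
  Σ≤ n (λ k → c k * mulS (F ∘ suc) (powS F k) n)
    ≡⟨ Σ≤-cong n (λ k → mulS-scaleʳ (c k) (F ∘ suc) (powS F k) n) ⟨
  Σ≤ n (λ k → mulS (F ∘ suc) (scaleS (c k) (powS F k)) n)           ≡⟨ mulS-Σ≤ʳ n (F ∘ suc) (λ k → scaleS (c k) (powS F k)) n ⟨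
  mulS (F ∘ suc) (λ m → Σ≤ n (λ k → c k * powS F k m)) n
    ≡⟨ Σ≤-cong-≤ n (λ i _ → cong (F (suc i) *_) (expS₁-extend F F0≡0 (ℕ.m∸n≤m n i))) ⟩
  mulS (F ∘ suc) (expS₁ F) n                                        ∎
  where
  c : ℕ → ℚ
  c k = invFact (suc k)

ℕ→ℚ≡mkℚ : ∀ n → ℕ→ℚ n ≡ mkℚ (+ n) 0 (Coprimality.sym (Coprimality.1-coprimeTo n))
ℕ→ℚ≡mkℚ n = ℚ.normalize-coprime (Coprimality.sym (Coprimality.1-coprimeTo n))

ℕ→ℚ-* : ∀ a b → ℕ→ℚ (a ℕ.* b) ≡ ℕ→ℚ a * ℕ→ℚ b
ℕ→ℚ-* a b = sym (begin
  ℕ→ℚ a * ℕ→ℚ b       ≡⟨ cong₂ _*_ (ℕ→ℚ≡mkℚ a) (ℕ→ℚ≡mkℚ b) ⟩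
  (+ a ℤ.* + b) / 1    ≡⟨ cong (_/ 1) (ℤ.pos-* a b) ⟨
  ℕ→ℚ (a ℕ.* b)       ∎)

1/suc*suc≡1 : ∀ m → (+ 1 / suc m) * ℕ→ℚ (suc m) ≡ 1ℚ
1/suc*suc≡1 m = trans
  (cong₂ _*_ (ℚ.normalize-coprime (Coprimality.1-coprimeTo (suc m))) (ℕ→ℚ≡mkℚ (suc m)))
  (ℚ.*-inverseˡ (mkℚ (+ suc m) 0 (Coprimality.sym (Coprimality.1-coprimeTo (suc m)))))

fact≡ℕ→ℚ[!] : ∀ k → fact k ≡ ℕ→ℚ (k !)
fact≡ℕ→ℚ[!] zero    = refl
fact≡ℕ→ℚ[!] (suc k) = begin
  fact k * ℕ→ℚ (suc k)        ≡⟨ cong (_* ℕ→ℚ (suc k)) (fact≡ℕ→ℚ[!] k) ⟩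
  ℕ→ℚ (k !) * ℕ→ℚ (suc k)    ≡⟨ ℕ→ℚ-* (k !) (suc k) ⟨
  ℕ→ℚ (k ! ℕ.* suc k)         ≡⟨ cong ℕ→ℚ (ℕ.*-comm (k !) (suc k)) ⟩
  ℕ→ℚ (suc k !)               ∎

nCk*k!*[n∸k]!≡n! : ∀ {n k} → k ≤ n → (n C k) ℕ.* (k ! ℕ.* (n ∸ k) !) ≡ n !
nCk*k!*[n∸k]!≡n! {n} {k} k≤n = begin
  (n C k) ℕ.* (k ! ℕ.* (n ∸ k) !)
    ≡⟨ cong (ℕ._* (k ! ℕ.* (n ∸ k) !)) (ℕ.nCk≡n!/k![n-k]! k≤n) ⟩
  (n ! ℕ./ (k ! ℕ.* (n ∸ k) !)) ℕ.* (k ! ℕ.* (n ∸ k) !)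
    ≡⟨ ℕ.m/n*n≡m (ℕ.k![n∸k]!∣n! k≤n) ⟩
  n !                                                     ∎
  where instance _ = k ℕ.!* (n ∸ k) !≢0

binomial-coeff : ∀ {n m} → m ≤ n →
  (+ 1 / suc m) * ℕ→ℚ (n C m) * fact (n ∸ m) * fact (suc m) ≡ fact n
binomial-coeff {n} {m} m≤n = begin
  i * b * q′ * (q * s)             ≡⟨ solve 5 (λ i b q′ q s → i :* b :* q′ :* (q :* s) := (i :* s) :* (b :* (q :* q′)))
                                              refl i b q′ q s ⟩
  (i * s) * (b * (q * q′))
    ≡⟨ cong₂ _*_ (1/suc*suc≡1 m) (cong (b *_) (cong₂ _*_ (fact≡ℕ→ℚ[!] m) (fact≡ℕ→ℚ[!] (n ∸ m)))) ⟩
  1ℚ * (b * (ℕ→ℚ (m !) * ℕ→ℚ ((n ∸ m) !)))    ≡⟨ ℚ.*-identityˡ _ ⟩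
  b * (ℕ→ℚ (m !) * ℕ→ℚ ((n ∸ m) !))
    ≡⟨ trans (ℕ→ℚ-* (n C m) _) (cong (b *_) (ℕ→ℚ-* (m !) _)) ⟨
  ℕ→ℚ ((n C m) ℕ.* (m ! ℕ.* (n ∸ m) !))      ≡⟨ cong ℕ→ℚ (nCk*k!*[n∸k]!≡n! m≤n) ⟩
  ℕ→ℚ (n !)                                  ≡⟨ fact≡ℕ→ℚ[!] n ⟨
  fact n                                     ∎
  where
  i b q q′ s : ℚ
  i = + 1 / suc m
  b = ℕ→ℚ (n C m)
  q = fact m
  q′ = fact (n ∸ m)
  s = ℕ→ℚ (suc m)

-- X and B enter through their exponential coefficients (k+1)! X_k and k! B_k.
binomial-convolution : ∀ n (X B : Series) →
  Σ≤ n (λ m → (+ 1 / suc m) * ℕ→ℚ (n C m) * (fact (n ∸ m) * B (n ∸ m)) * (fact (suc m) * X m))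
  ≡ fact n * mulS X B n
binomial-convolution n X B = begin
  Σ≤ n (λ m → (+ 1 / suc m) * ℕ→ℚ (n C m) * (fact (n ∸ m) * B (n ∸ m)) * (fact (suc m) * X m))
    ≡⟨ Σ≤-cong-≤ n (λ m m≤n → trans
         (solve 6 (λ i b f′ β f x → i :* b :* (f′ :* β) :* (f :* x) := (i :* b :* f′ :* f) :* (x :* β)) refl
            (+ 1 / suc m) (ℕ→ℚ (n C m)) (fact (n ∸ m)) (B (n ∸ m)) (fact (suc m)) (X m))
         (cong (_* (X m * B (n ∸ m))) (binomial-coeff m≤n))) ⟩
  Σ≤ n (λ m → fact n * (X m * B (n ∸ m)))    ≡⟨ *-distribˡ-Σ≤ n (fact n) _ ⟨
  fact n * mulS X B n                        ∎

eλm1/t-0 : ∀ lam → eλm1/t lam 0 ≡ 1ℚ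
eλm1/t-0 lam = cong (λ z → (1ℚ * (1ℚ + - z)) * (1ℚ * (+ 1 / 1))) (ℚ.*-zeroˡ lam)

bell-quotient : ∀ lam x →
  mulS (expS (scaleS x (eλm1 lam)) ∘ suc) (invS (eλm1/t lam)) ≐ scaleS x (expS₁ (scaleS x (eλm1 lam)))
bell-quotient lam x n = begin
  mulS (expS G ∘ suc) (invS D) n                     ≡⟨ mulS-congˡ (invS D) (expS-suc G (ℚ.*-zeroʳ x)) n ⟩
  mulS (mulS (scaleS x D) (expS₁ G)) (invS D) n      ≡⟨ mulS-congˡ (invS D) (mulS-scaleˡ x D (expS₁ G)) n ⟩
  mulS (scaleS x (mulS D (expS₁ G))) (invS D) n      ≡⟨ mulS-scaleˡ x _ (invS D) n ⟩
  x * mulS (mulS D (expS₁ G)) (invS D) n             ≡⟨ cong (x *_) (mulS-invS-cancel D (eλm1/t-0 lam) (expS₁ G) n) ⟩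
  x * expS₁ G n                                      ∎
  where
  G D : Series
  G = scaleS x (eλm1 lam)
  D = eλm1/t lam

theorem2 : (lam x : ℚ) (n : ℕ) →
    (x * Bel1 n lam x ≡ Σ≤ n (λ m → (+ 1 / suc m) * ℕ→ℚ (n C m) * β (n ∸ m) lam * Bel (suc m) lam x))
    × (Bel1 n lam 1ℚ ≡ Σ≤ n (λ m → (+ 1 / suc m) * ℕ→ℚ (n C m) * β (n ∸ m) lam * Bel (suc m) lam 1ℚ))
theorem2 lam x n = identity x , trans (sym (ℚ.*-identityˡ (Bel1 n lam 1ℚ))) (identity 1ℚ)
  where
  identity : ∀ y →
    y * Bel1 n lam y ≡ Σ≤ n (λ m → (+ 1 / suc m) * ℕ→ℚ (n C m) * β (n ∸ m) lam * Bel (suc m) lam y)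
  identity y = begin
    y * (fact n * expS₁ G n)                          ≡⟨ solve 3 (λ y f e → y :* (f :* e) := f :* (y :* e)) refl y (fact n) _ ⟩
    fact n * (y * expS₁ G n)                          ≡⟨ cong (fact n *_) (bell-quotient lam y n) ⟨
    fact n * mulS (expS G ∘ suc) (invS (eλm1/t lam)) n ≡⟨ binomial-convolution n (expS G ∘ suc) (invS (eλm1/t lam)) ⟨
    Σ≤ n (λ m → (+ 1 / suc m) * ℕ→ℚ (n C m) * β (n ∸ m) lam * Bel (suc m) lam y) ∎
    where
    G : Series
    G = scaleS y (eλm1 lam)
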